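{- Let $d\geq 0$ and $0<i\leq d+1$ be integers, and let $\Delta$ be a $d$-dimensional simplicial complex with $\tilde{H}_d(\Delta;\mathbb{Z})\neq 0$ and with no missing faces of dimension $>i$. Then for every face $F\in\Delta$, the link $\operatorname{lk}(F,\Delta)$ has no missing faces of dimension $>i$.
   Context: A set $T$ of vertices is a missing face of a simplicial complex $\Gamma$ if $T\notin\Gamma$ but every proper subset of $T$ is in $\Gamma$; its dimension is $|T|-1$. $\tilde H$ denotes reduced homology. The link of a face $F\in\Delta$ is $\operatorname{lk}(F,\Delta)=\{T\in\Delta: T\cap F=\emptyset,\ T\cup F\in\Delta\}$. -}

module Defs where

open import Data.Bool using (Bool; true; false; if_then_else_)
open import Data.Nat using (ℕ; zero; suc; _<ᵇ_; _≤_; _<_)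
open import Data.Integer using (ℤ; 0ℤ; 1ℤ; -_; _+_; _*_)
open import Data.Fin using (Fin; toℕ)
import Data.Fin as Fin
open import Data.Fin.Subset using (Subset; _⊆_; _⊂_; _∩_; _∪_; ⁅_⁆; ∣_∣; Empty)
open import Data.Vec using (lookup; tabulate)
open import Data.Product using (_×_; ∃; ∃-syntax)
open import Relation.Nullary using (¬_)
open import Relation.Binary.PropositionalEquality using (_≡_)

IsSimplicialComplex : ∀ {n} → (Subset n → Set) → Set
IsSimplicialComplex {n} Δ = ∀ (F G : Subset n) → G ⊆ F → Δ F → Δ G

HasDimension : ∀ {n} → (Subset n → Set) → ℕ → Set
HasDimension {n} Δ d = (∃[ F ] (Δ F × ∣ F ∣ ≡ suc d)) × (∀ F → Δ F → ∣ F ∣ ≤ suc d)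

IsMissingFace : ∀ {n} → (Subset n → Set) → Subset n → Set
IsMissingFace {n} Γ T = ¬ Γ T × (∀ (S : Subset n) → S ⊂ T → Γ S)

-- Γ has no missing faces of dimension > i  (dimension of T is |T| - 1).
NoMissingFacesAbove : ∀ {n} → (Subset n → Set) → ℕ → Set
NoMissingFacesAbove {n} Γ i = ∀ (T : Subset n) → IsMissingFace Γ T → ¬ (suc i < ∣ T ∣)

link : ∀ {n} → (Subset n → Set) → Subset n → Subset n → Set
link Δ F T = Empty (T ∩ F) × Δ (T ∪ F)

-- A chain is a function Subset n → ℤ; a k-chain (for "size" k, i.e.
-- dimension k-1) of Δ is one supported on faces of Δ of size k.
-- Size 0 is the empty face, giving the augmented (reduced) complex.

sumFin : ∀ {n} → (Fin n → ℤ) → ℤ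
sumFin {zero}  f = 0ℤ
sumFin {suc n} f = f Fin.zero + sumFin (λ j → f (Fin.suc j))

below : ∀ {n} → Fin n → Subset n
below v = tabulate (λ u → toℕ u <ᵇ toℕ v)

sign : ℕ → ℤ
sign zero    = 1ℤ
sign (suc k) = - sign k

∂ : ∀ {n} → (Subset n → ℤ) → Subset n → ℤ
∂ c T = sumFin (λ v → if lookup T v then 0ℤ
                       else sign ∣ T ∩ below v ∣ * c (T ∪ ⁅ v ⁆))

IsChain : ∀ {n} → (Subset n → Set) → ℕ → (Subset n → ℤ) → Set
IsChain Δ k c = ∀ S → ¬ c S ≡ 0ℤ → Δ S × ∣ S ∣ ≡ k

-- H̃_d(Δ; ℤ) ≠ 0 : there is a d-cycle (chain on faces of size d+1 with zero
-- boundary) which is not the boundary of a (d+1)-chain.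
ReducedHomologyNonzero : ∀ {n} → (Subset n → Set) → ℕ → Set
ReducedHomologyNonzero {n} Δ d =
  ∃[ z ] (IsChain Δ (suc d) z × (∀ T → ∂ z T ≡ 0ℤ)
          × ¬ (∃[ b ] (IsChain Δ (suc (suc d)) b × (∀ S → ∂ b S ≡ z S))))

module Submission where

-- Let T be a missing face of lk(F, Δ) with |T| > i + 1.  Every proper subset of T
-- lies in the link, so T is disjoint from F (as |T| ≥ 2), and every set
-- X ⊆ T ∪ F not containing T lies in Δ, being contained in (T ∩ X) ∪ F.  By
-- induction on |X|, each X with T ⊆ X ⊆ T ∪ F is in Δ: otherwise it would be a
-- missing face of Δ of size ≥ |T| > i + 1.  Hence T ∪ F ∈ Δ, i.e. T ∈ lk(F, Δ),
-- a contradiction.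

open import Defs
open import Data.Nat using (ℕ; zero; suc; _≤_; _<_; z≤n; s≤s)
open import Data.Nat.Properties using (≤-trans; <-≤-trans; ≤⇒≯; n<1+n)
open import Data.Fin.Subset using (Subset; _⊆_; _⊂_; _∈_; _∉_; _∩_; _∪_; ⁅_⁆; ∣_∣; Empty)
open import Data.Fin.Subset.Properties
  using (_∈?_; _⊆?_; p⊂q⇒p⊆q; p⊆q⇒∣p∣≤∣q∣; p⊂q⇒∣p∣<∣q∣; p∩q⊆p; p∩q⊆q; x∈p∩q⁺; x∈p∩q⁻;
         p⊆p∪q; x∈p∪q⁺; x∈p∪q⁻; x∈⁅x⁆; x∈⁅y⁆⇒x≡y; ∣⁅x⁆∣≡1)
open import Data.Fin.Properties using (¬∀⟶∃¬)
open import Data.Bool using (true; false)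
open import Data.Vec using ([]; _∷_)
open import Data.Product using (∃; _×_; _,_; proj₁; proj₂)
import Data.Sum as Sum
open import Data.Empty using (⊥-elim)
open import Function using (id; const; _∘_)
open import Relation.Nullary using (¬_; yes; no)
open import Relation.Nullary.Decidable using (_→-dec_; decidable-stable)
open import Relation.Unary using (Decidable)
open import Relation.Binary.PropositionalEquality using (subst; sym)

¬¬-Decidable : ∀ {n p} (P : Subset n → Set p) → ¬ ¬ Decidable P
¬¬-Decidable {zero} P k = k λ { [] → no λ p → k λ { [] → yes p } }
¬¬-Decidable {suc n} P k =
  ¬¬-Decidable (P ∘ (true ∷_)) λ P-in? →
  ¬¬-Decidable (P ∘ (false ∷_)) λ P-out? →
  k λ { (true ∷ X) → P-in? X ; (false ∷ X) → P-out? X }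

⊈⇒∃∈∉ : ∀ {n} {p q : Subset n} → ¬ p ⊆ q → ∃ λ x → x ∈ p × x ∉ q
⊈⇒∃∈∉ {n} {p} {q} p⊈q with ¬∀⟶∃¬ n _ (λ x → x ∈? p →-dec x ∈? q) (λ p⊆q → p⊈q (p⊆q _))
... | x , ¬[x∈p⇒x∈q] =
  x , decidable-stable (x ∈? p) (λ x∉p → ¬[x∈p⇒x∈q] (⊥-elim ∘ x∉p)) , ¬[x∈p⇒x∈q] ∘ const

p⊆q∧∣p∣<∣q∣⇒p⊂q : ∀ {n} {p q : Subset n} → p ⊆ q → ∣ p ∣ < ∣ q ∣ → p ⊂ q
p⊆q∧∣p∣<∣q∣⇒p⊂q p⊆q ∣p∣<∣q∣ with ⊈⇒∃∈∉ (λ q⊆p → ≤⇒≯ (p⊆q⇒∣p∣≤∣q∣ q⊆p) ∣p∣<∣q∣)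
... | x , x∈q , x∉p = p⊆q , x , x∈q , x∉p

module MissingFaceOfLink {n} {Δ : Subset n → Set} (closed : IsSimplicialComplex Δ)
  {F T : Subset n} (T-missing : IsMissingFace (link Δ F) T) where

  proper⇒link : ∀ {S} → S ⊂ T → link Δ F S
  proper⇒link = proj₂ T-missing _

  disjoint : 1 < ∣ T ∣ → Empty (T ∩ F)
  disjoint 1<∣T∣ (x , x∈T∩F) with x∈p∩q⁻ T F x∈T∩F
  ... | x∈T , x∈F = proj₁ (proper⇒link ⁅x⁆⊂T) (x , x∈p∩q⁺ (x∈⁅x⁆ x , x∈F))
    where
    ⁅x⁆⊆T : ⁅ x ⁆ ⊆ T
    ⁅x⁆⊆T y∈⁅x⁆ = subst (_∈ T) (sym (x∈⁅y⁆⇒x≡y x y∈⁅x⁆)) x∈T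
    ⁅x⁆⊂T : ⁅ x ⁆ ⊂ T
    ⁅x⁆⊂T = p⊆q∧∣p∣<∣q∣⇒p⊂q ⁅x⁆⊆T (subst (_< ∣ T ∣) (sym (∣⁅x⁆∣≡1 x)) 1<∣T∣)

  ⊈-face : ∀ {Y} → Y ⊆ T ∪ F → ¬ T ⊆ Y → Δ Y
  ⊈-face {Y} Y⊆T∪F T⊈Y with ⊈⇒∃∈∉ T⊈Y
  ... | x , x∈T , x∉Y = closed ((T ∩ Y) ∪ F) Y Y⊆[T∩Y]∪F (proj₂ (proper⇒link T∩Y⊂T))
    where
    T∩Y⊂T : T ∩ Y ⊂ T
    T∩Y⊂T = p∩q⊆p T Y , x , x∈T , x∉Y ∘ p∩q⊆q T Y
    Y⊆[T∩Y]∪F : Y ⊆ (T ∩ Y) ∪ F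
    Y⊆[T∩Y]∪F y∈Y =
      x∈p∪q⁺ (Sum.map (λ y∈T → x∈p∩q⁺ (y∈T , y∈Y)) id (x∈p∪q⁻ T F (Y⊆T∪F y∈Y)))

  module _ (Δ? : Decidable Δ) {i} (no-missing : NoMissingFacesAbove Δ i)
    (T-large : suc i < ∣ T ∣) where

    between-face : ∀ k X → ∣ X ∣ < k → T ⊆ X → X ⊆ T ∪ F → Δ X
    between-face (suc k) X (s≤s ∣X∣≤k) T⊆X X⊆T∪F with Δ? X
    ... | yes ΔX = ΔX
    ... | no ¬ΔX = ⊥-elim (no-missing X (¬ΔX , proper-face) (<-≤-trans T-large (p⊆q⇒∣p∣≤∣q∣ T⊆X)))
      where
      proper-face : ∀ Y → Y ⊂ X → Δ Y
      proper-face Y Y⊂X with T ⊆? Y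
      ... | yes T⊆Y =
        between-face k Y (<-≤-trans (p⊂q⇒∣p∣<∣q∣ Y⊂X) ∣X∣≤k) T⊆Y (X⊆T∪F ∘ p⊂q⇒p⊆q Y⊂X)
      ... | no T⊈Y = ⊈-face (X⊆T∪F ∘ p⊂q⇒p⊆q Y⊂X) T⊈Y

    T∈link : link Δ F T
    T∈link = disjoint (≤-trans (s≤s (s≤s z≤n)) T-large)
           , between-face _ (T ∪ F) (n<1+n _) (p⊆p∪q F) id

lemma2p3 : ∀ {n} (Δ : Subset n → Set) → IsSimplicialComplex Δ →
    (d i : ℕ) → 0 < i → i ≤ suc d →
    HasDimension Δ d → ReducedHomologyNonzero Δ d → NoMissingFacesAbove Δ i →
    ∀ (F : Subset n) → Δ F → NoMissingFacesAbove (link Δ F) i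
lemma2p3 Δ closed _ _ _ _ _ _ no-missing _ _ T T-missing T-large =
  ¬¬-Decidable Δ λ Δ? → proj₁ T-missing (T∈link Δ? no-missing T-large)
  where open MissingFaceOfLink closed T-missing
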